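{- Let $n\ge2$ and let $B$ be a compressed family of even-size subsets of $[n]$ that is not an initial segment of weightlex-even order. Let $x$ be an even-size subset of $[n]$ with $x\notin B$, and $y\in B$, with $x$ preceding $y$ in weightlex order. Then exactly one of the following holds: (1) $|x\cap y|=1$ and $x\cup y=[n]$; (2) $|x\cap y|=0$ and $x\cup y=[n]\setminus\{k\}$ for some $k$; (3) $x=[n]\setminus y$.
   Context: Weightlex order on subsets of a totally ordered finite set: $x\le_{lex}y$ iff $x=y$ or $\min(x\triangle y)\in x$; $x$ precedes $y$ iff $|x|<|y|$, or $|x|=|y|$ and $x<_{lex}y$. An initial segment of weightlex-even order is the set of the first $k$ even-size subsets of $[n]$ in weightlex order, for some $k$. Compression: for a 2-element $\{i,j\}\subseteq[n]$ and a family $A$ of even-size subsets of $[n]$, let $S=[n]\setminus\{i,j\}$ and $A_{0,0}=\{x\in A:i,j\notin x\}$, $A_{0,1}=\{x\setminus\{i\}:x\in A,i\in x,j\notin x\}$, $A_{1,0}=\{x\setminus\{j\}:x\in A,i\notin x,j\in x\}$, $A_{1,1}=\{x\setminus\{i,j\}:x\in A,i,j\in x\}$. $C_{i,j}(A)=B_{0,0}\cup\{y\cup\{i\}:y\in B_{0,1}\}\cup\{y\cup\{j\}:y\in B_{1,0}\}\cup\{y\cup\{i,j\}:y\in B_{1,1}\}$, where $B_{0,0}$ (resp. $B_{1,1}$) consists of the first $|A_{0,0}|$ (resp. $|A_{1,1}|$) even-size subsets of $S$ in weightlex order and $B_{0,1}$ (resp. $B_{1,0}$) of the first $|A_{0,1}|$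 (resp. $|A_{1,0}|$) odd-size subsets of $S$ in weightlex order. $A$ is compressed if $C_{i,j}(A)=A$ for all 2-element $\{i,j\}\subseteq[n]$. -}

module Defs where

open import Data.Bool using (Bool; true; false; if_then_else_; not; _∧_; _∨_)
open import Data.Nat using (ℕ; zero; suc; _<ᵇ_; _≡ᵇ_)
open import Data.Fin using (Fin)
open import Data.Vec using (Vec; []; _∷_; lookup; _[_]≔_)
open import Data.List using (List; []; _∷_; _++_; map; length; filterᵇ)
open import Data.Fin.Subset using (Subset; inside; outside; ∣_∣)

-- Subsets of [n] = Fin n, with the usual order on Fin n (index 0 smallest).
-- A family of subsets is given by its characteristic function.
Family : ℕ → Set
Family n = Subset n → Bool

allSubsets : (n : ℕ) → List (Subset n)
allSubsets zero = [] ∷ []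
allSubsets (suc n) = map (inside ∷_) (allSubsets n) ++ map (outside ∷_) (allSubsets n)

count : {n : ℕ} → (Subset n → Bool) → ℕ
count {n} p = length (filterᵇ p (allSubsets n))

isEven : ℕ → Bool
isEven zero = true
isEven (suc m) = not (isEven m)

evenSize : {n : ℕ} → Subset n → Bool
evenSize x = isEven ∣ x ∣

-- strict lex order: x <lex y iff x ≠ y and min (x △ y) ∈ x,
-- i.e. at the first (smallest) position where x and y differ, x contains it.
_<lex_ : {n : ℕ} → Subset n → Subset n → Bool
[] <lex [] = false
(a ∷ x) <lex (b ∷ y) with a | b
... | true  | true  = x <lex y
... | false | false = x <lex y
... | true  | false = true
... | false | true  = false

_≺_ : {n : ℕ} → Subset n → Subset n → Bool
x ≺ y = (∣ x ∣ <ᵇ ∣ y ∣) ∨ ((∣ x ∣ ≡ᵇ ∣ y ∣) ∧ (x <lex y))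

-- membership in the initial segment of length k of weightlex order restricted
-- to the subsets z satisfying 'cls' (a class of subsets closed as needed):
-- z is among the first k elements of cls iff fewer than k elements of cls precede z.
firstK : {n : ℕ} → (Subset n → Bool) → ℕ → Subset n → Bool
firstK cls k z = cls z ∧ (count (λ w → cls w ∧ (w ≺ z)) <ᵇ k)

isInitialSegmentEven : {n : ℕ} → Family n → Set
isInitialSegmentEven {n} A =
  Σ′ ℕ (λ k → (x : Subset n) → A x ≡′ firstK evenSize k x)
  where
    open import Data.Product using () renaming (Σ to Σ′)
    open import Relation.Binary.PropositionalEquality using () renaming (_≡_ to _≡′_)

inS : {n : ℕ} → Fin n → Fin n → Subset n → Bool
inS i j z = not (lookup z i) ∧ not (lookup z j)

evenInS oddInS : {n : ℕ} → Fin n → Fin n → Subset n → Bool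
evenInS i j z = inS i j z ∧ evenSize z
oddInS  i j z = inS i j z ∧ not (evenSize z)

compress : {n : ℕ} → Fin n → Fin n → Family n → Family n
compress {n} i j A x = go (lookup x i) (lookup x j)
  where
    y : Subset n
    y = (x [ i ]≔ outside) [ j ]≔ outside
    -- |A_{a,b}| (the maps x ↦ x \ {i,j} are injective on each part)
    sz : Bool → Bool → ℕ
    sz a b = count (λ w → A w ∧ (if a then lookup w i else not (lookup w i))
                             ∧ (if b then lookup w j else not (lookup w j)))
    go : Bool → Bool → Bool
    go false false = firstK (evenInS i j) (sz false false) y   -- B_{0,0}
    go true  false = firstK (oddInS  i j) (sz true  false) y   -- B_{0,1} ∪ {i}
    go false true  = firstK (oddInS  i j) (sz false true ) y   -- B_{1,0} ∪ {j}
    go true  true  = firstK (evenInS i j) (sz true  true ) y   -- B_{1,1} ∪ {i,j}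

module Submission where

-- If x and y agree on two coordinates i ≠ j, they lie in the same part B_{a,b} of the
-- {i,j}-compression and, after deleting i and j, in the same parity class of subsets of
-- [n] \ {i,j}, still in the same weightlex order. Compression makes each part an initial
-- segment of its class, so y ∈ B forces x ∈ B. Hence a missing x preceding some y ∈ B agrees
-- with y in at most one coordinate: in none (x = ∁ y), or in a single k that lies in both
-- (case 1) or in neither (case 2).

open import Defs
open import Data.Bool using (Bool; true; false)
open import Data.Nat using (ℕ; _≤_)
open import Data.Fin using (Fin)
open import Data.Fin.Subset using (Subset; ∣_∣; _∩_; _∪_; ⊤; ∁; ⁅_⁆)
open import Data.Product using (_×_; ∃)
open import Data.Sum using (_⊎_)
open import Relation.Nullary using (¬_)
open import Relation.Binary.PropositionalEquality using (_≡_; _≢_)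

open import Data.Bool using (T; T?; not; _∧_; _∨_; _xor_; if_then_else_)
open import Data.Bool.Properties using (not-injective; ∧-conicalˡ; ∧-conicalʳ; ∨-zeroʳ; T-≡)
open import Data.Empty using (⊥-elim)
open import Data.Fin using (zero; suc)
open import Data.Fin.Properties using (suc-injective)
open import Data.Fin.Subset using (outside; _∈_)
open import Data.Fin.Subset.Properties using (∩-inverseˡ; ∪-inverseˡ; ∣⊥∣≡0; ∈⊤; x∈⁅x⁆; x∈p⇒x∉∁p)
open import Data.List.Relation.Binary.Sublist.Propositional using (⊆-refl)
open import Data.List.Relation.Binary.Sublist.Propositional.Properties
  using (filter⁺; length-mono-≤)
open import Data.Nat using (zero; suc; _+_; _<_; _<ᵇ_; _≡ᵇ_)
open import Data.Nat.Properties using (+-suc; <ᵇ⇒<; <⇒<ᵇ; ≡ᵇ⇒≡; ≡⇒≡ᵇ; <-trans; ≤-<-trans)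
open import Data.Product using (_,_)
open import Data.Sum using (inj₁; inj₂)
open import Data.Vec using ([]; _∷_; lookup; _[_]≔_)
open import Data.Vec.Properties using (lookup∘update; lookup∘update′; map-replicate)
open import Function using (_∘_)
open import Function.Bundles using (Equivalence)
open import Relation.Binary.PropositionalEquality
  using (refl; sym; trans; cong; cong₂; subst; subst₂; module ≡-Reasoning)

T⇒≡true : ∀ {b} → T b → b ≡ true
T⇒≡true = Equivalence.to T-≡

≡true⇒T : ∀ {b} → b ≡ true → T b
≡true⇒T = Equivalence.from T-≡

count-mono : ∀ {n} {p q : Subset n → Bool} →
             (∀ w → p w ≡ true → q w ≡ true) → count p ≤ count q
count-mono {n} {p} {q} p⇒q =
  length-mono-≤ (filter⁺ (T? ∘ p) (T? ∘ q) (λ { {w} refl → ≡true⇒T ∘ p⇒q w ∘ T⇒≡true })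
                         (⊆-refl {x = allSubsets n}))

+-cancelˡ-<ᵇ : ∀ d m n → (d + m <ᵇ d + n) ≡ (m <ᵇ n)
+-cancelˡ-<ᵇ zero    m n = refl
+-cancelˡ-<ᵇ (suc d) m n = +-cancelˡ-<ᵇ d m n

+-cancelˡ-≡ᵇ : ∀ d m n → (d + m ≡ᵇ d + n) ≡ (m ≡ᵇ n)
+-cancelˡ-≡ᵇ zero    m n = refl
+-cancelˡ-≡ᵇ (suc d) m n = +-cancelˡ-≡ᵇ d m n

isEven-cancelˡ : ∀ d m n → isEven (d + m) ≡ isEven (d + n) → isEven m ≡ isEven n
isEven-cancelˡ zero    m n e = e
isEven-cancelˡ (suc d) m n e = isEven-cancelˡ d m n (not-injective e)

WeightLex : ∀ {n} → Subset n → Subset n → Set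
WeightLex x y = ∣ x ∣ < ∣ y ∣ ⊎ (∣ x ∣ ≡ ∣ y ∣ × x <lex y ≡ true)

≺⇒WeightLex : ∀ {n} (x y : Subset n) → x ≺ y ≡ true → WeightLex x y
≺⇒WeightLex x y x≺y with ∣ x ∣ <ᵇ ∣ y ∣ in lt | ∣ x ∣ ≡ᵇ ∣ y ∣ in eq
... | true  | _    = inj₁ (<ᵇ⇒< _ _ (≡true⇒T lt))
... | false | true = inj₂ (≡ᵇ⇒≡ _ _ (≡true⇒T eq) , x≺y)

WeightLex⇒≺ : ∀ {n} (x y : Subset n) → WeightLex x y → x ≺ y ≡ true
WeightLex⇒≺ x y (inj₁ lt) rewrite T⇒≡true (<⇒<ᵇ lt) = refl
WeightLex⇒≺ x y (inj₂ (eq , lex))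
  rewrite eq | T⇒≡true (≡⇒≡ᵇ ∣ y ∣ ∣ y ∣ refl) | lex = ∨-zeroʳ _

<lex-trans : ∀ {n} (x y z : Subset n) → x <lex y ≡ true → y <lex z ≡ true → x <lex z ≡ true
<lex-trans []          []          []          () _
<lex-trans (true  ∷ x) (true  ∷ y) (true  ∷ z) p q = <lex-trans x y z p q
<lex-trans (true  ∷ x) (true  ∷ y) (false ∷ z) p q = refl
<lex-trans (true  ∷ x) (false ∷ y) (false ∷ z) p q = refl
<lex-trans (false ∷ x) (false ∷ y) (false ∷ z) p q = <lex-trans x y z p q

WeightLex-trans : ∀ {n} (x y z : Subset n) → WeightLex x y → WeightLex y z → WeightLex x z
WeightLex-trans x y z (inj₁ a)       (inj₁ b)         = inj₁ (<-trans a b)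
WeightLex-trans x y z (inj₁ a)       (inj₂ (e , _))   = inj₁ (subst (∣ x ∣ <_) e a)
WeightLex-trans x y z (inj₂ (e , _)) (inj₁ b)         = inj₁ (subst (_< ∣ z ∣) (sym e) b)
WeightLex-trans x y z (inj₂ (e , l)) (inj₂ (e′ , l′)) = inj₂ (trans e e′ , <lex-trans x y z l l′)

≺-trans : ∀ {n} (x y z : Subset n) → x ≺ y ≡ true → y ≺ z ≡ true → x ≺ z ≡ true
≺-trans x y z p q =
  WeightLex⇒≺ x z (WeightLex-trans x y z (≺⇒WeightLex x y p) (≺⇒WeightLex y z q))

firstK-downClosed : ∀ {n} (cls : Subset n → Bool) k {w z : Subset n} →
                    cls w ≡ true → w ≺ z ≡ true → firstK cls k z ≡ true → firstK cls k w ≡ true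
firstK-downClosed {n} cls k {w} {z} cls-w w≺z z∈ = cong₂ _∧_ cls-w (T⇒≡true (<⇒<ᵇ rank-w<k))
  where
  rank : Subset n → ℕ
  rank u = count (λ v → cls v ∧ (v ≺ u))
  rank-w≤rank-z : rank w ≤ rank z
  rank-w≤rank-z = count-mono λ v p →
    cong₂ _∧_ (∧-conicalˡ _ _ p) (≺-trans v w z (∧-conicalʳ (cls v) _ p) w≺z)
  rank-w<k : rank w < k
  rank-w<k = ≤-<-trans rank-w≤rank-z (<ᵇ⇒< _ _ (≡true⇒T (∧-conicalʳ (cls z) _ z∈)))

bit : Bool → ℕ
bit true  = 1
bit false = 0

∣p∣≡bit+∣p-i∣ : ∀ {n} (p : Subset n) i → ∣ p ∣ ≡ bit (lookup p i) + ∣ p [ i ]≔ outside ∣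
∣p∣≡bit+∣p-i∣ (true  ∷ p) zero    = refl
∣p∣≡bit+∣p-i∣ (false ∷ p) zero    = refl
∣p∣≡bit+∣p-i∣ (true  ∷ p) (suc i) = trans (cong suc (∣p∣≡bit+∣p-i∣ p i)) (sym (+-suc _ _))
∣p∣≡bit+∣p-i∣ (false ∷ p) (suc i) = ∣p∣≡bit+∣p-i∣ p i

<lex-remove : ∀ {n} (x y : Subset n) i → lookup x i ≡ lookup y i →
              (x [ i ]≔ outside) <lex (y [ i ]≔ outside) ≡ x <lex y
<lex-remove (true  ∷ x) (true  ∷ y) zero    _ = refl
<lex-remove (false ∷ x) (false ∷ y) zero    _ = refl
<lex-remove (true  ∷ x) (true  ∷ y) (suc i) e = <lex-remove x y i e
<lex-remove (false ∷ x) (false ∷ y) (suc i) e = <lex-remove x y i e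
<lex-remove (true  ∷ x) (false ∷ y) (suc i) _ = refl
<lex-remove (false ∷ x) (true  ∷ y) (suc i) _ = refl

module _ {n} (x y : Subset n) (i : Fin n) (agree : lookup x i ≡ lookup y i) where

  private
    d = bit (lookup x i)

    ∣y∣≡d+∣y-i∣ : ∣ y ∣ ≡ d + ∣ y [ i ]≔ outside ∣
    ∣y∣≡d+∣y-i∣ = subst (λ b → ∣ y ∣ ≡ bit b + _) (sym agree) (∣p∣≡bit+∣p-i∣ y i)

  ≺-remove : (x [ i ]≔ outside) ≺ (y [ i ]≔ outside) ≡ x ≺ y
  ≺-remove = sym (cong₂ _∨_
    (trans (cong₂ _<ᵇ_ (∣p∣≡bit+∣p-i∣ x i) ∣y∣≡d+∣y-i∣) (+-cancelˡ-<ᵇ d _ _))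
    (cong₂ _∧_ (trans (cong₂ _≡ᵇ_ (∣p∣≡bit+∣p-i∣ x i) ∣y∣≡d+∣y-i∣) (+-cancelˡ-≡ᵇ d _ _))
               (sym (<lex-remove x y i agree))))

  evenSize-remove : evenSize x ≡ evenSize y →
                    evenSize (x [ i ]≔ outside) ≡ evenSize (y [ i ]≔ outside)
  evenSize-remove same = isEven-cancelˡ d _ _ (begin
    isEven (d + ∣ x [ i ]≔ outside ∣) ≡⟨ cong isEven (sym (∣p∣≡bit+∣p-i∣ x i)) ⟩
    evenSize x                         ≡⟨ same ⟩
    evenSize y                         ≡⟨ cong isEven ∣y∣≡d+∣y-i∣ ⟩
    isEven (d + ∣ y [ i ]≔ outside ∣) ∎)
    where open ≡-Reasoning

module Compression {n} (B : Family n) (i j : Fin n) (i≢j : i ≢ j) where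

  remove : Subset n → Subset n
  remove z = (z [ i ]≔ outside) [ j ]≔ outside

  -- The class of subsets of [n] \ {i, j} from which B_{a,b} is drawn.
  part : Bool → Bool → Subset n → Bool
  part a b z = inS i j z ∧ (if a xor b then not (evenSize z) else evenSize z)

  partSize : Bool → Bool → ℕ
  partSize a b = count (λ w → B w ∧ (if a then lookup w i else not (lookup w i))
                                  ∧ (if b then lookup w j else not (lookup w j)))

  compress-unfold : ∀ z → compress i j B z ≡
    firstK (part (lookup z i) (lookup z j)) (partSize (lookup z i) (lookup z j)) (remove z)
  compress-unfold z with lookup z i | lookup z j
  ... | false | false = refl
  ... | false | true  = refl
  ... | true  | false = refl
  ... | true  | true  = refl

  lookup-remove-i : ∀ z → lookup (remove z) i ≡ outside
  lookup-remove-i z =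
    trans (lookup∘update′ i≢j (z [ i ]≔ outside) outside) (lookup∘update i z outside)

  lookup-remove-j : ∀ z → lookup (remove z) j ≡ outside
  lookup-remove-j z = lookup∘update j (z [ i ]≔ outside) outside

  module _ (x y : Subset n)
           (agree-i : lookup x i ≡ lookup y i) (agree-j : lookup x j ≡ lookup y j) where

    private
      agree-j′ : lookup (x [ i ]≔ outside) j ≡ lookup (y [ i ]≔ outside) j
      agree-j′ = trans (lookup∘update′ (i≢j ∘ sym) x outside)
                   (trans agree-j (sym (lookup∘update′ (i≢j ∘ sym) y outside)))

    ≺-remove₂ : remove x ≺ remove y ≡ x ≺ y
    ≺-remove₂ = trans (≺-remove (x [ i ]≔ outside) (y [ i ]≔ outside) j agree-j′)
                      (≺-remove x y i agree-i)

    evenSize-remove₂ : evenSize x ≡ evenSize y → evenSize (remove x) ≡ evenSize (remove y)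
    evenSize-remove₂ = evenSize-remove (x [ i ]≔ outside) (y [ i ]≔ outside) j agree-j′
                     ∘ evenSize-remove x y i agree-i

    part-remove : ∀ a b → evenSize x ≡ evenSize y → part a b (remove x) ≡ part a b (remove y)
    part-remove a b same = cong₂ _∧_
      (cong₂ _∧_ (cong not (trans (lookup-remove-i x) (sym (lookup-remove-i y))))
                 (cong not (trans (lookup-remove-j x) (sym (lookup-remove-j y)))))
      (cong (λ e → if a xor b then not e else e) (evenSize-remove₂ same))

    compressed-downClosed : (∀ z → compress i j B z ≡ B z) → evenSize x ≡ evenSize y →
                            B y ≡ true → x ≺ y ≡ true → B x ≡ true
    compressed-downClosed compressed same y∈B x≺y = begin
      B x                          ≡⟨ sym (compressed x) ⟩
      compress i j B x             ≡⟨ compress-unfold x ⟩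
      firstK cls k (remove x)      ≡⟨ firstK-downClosed cls k cls-x (trans ≺-remove₂ x≺y) y∈ ⟩
      true                         ∎
      where
      open ≡-Reasoning
      cls = part (lookup x i) (lookup x j)
      k = partSize (lookup x i) (lookup x j)
      y∈ : firstK cls k (remove y) ≡ true
      y∈ = subst₂ (λ a b → firstK (part a b) (partSize a b) (remove y) ≡ true)
                  (sym agree-i) (sym agree-j)
                  (trans (sym (compress-unfold y)) (trans (compressed y) y∈B))
      cls-x : cls (remove x) ≡ true
      cls-x = trans (part-remove (lookup x i) (lookup x j) same) (∧-conicalˡ _ _ y∈)

AgreeAtMostOnce : ∀ {n} → Subset n → Subset n → Set
AgreeAtMostOnce x y = ∀ i j → i ≢ j → lookup x i ≡ lookup y i → lookup x j ≢ lookup y j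

MeetOnceCovering DisjointMissingOne : ∀ {n} → Subset n → Subset n → Set
MeetOnceCovering   x y = (∣ x ∩ y ∣ ≡ 1) × (x ∪ y ≡ ⊤)
DisjointMissingOne x y = (∣ x ∩ y ∣ ≡ 0) × ∃ (λ k → x ∪ y ≡ ∁ ⁅ k ⁆)

∣∁p∩p∣≡0 : ∀ {n} (p : Subset n) → ∣ ∁ p ∩ p ∣ ≡ 0
∣∁p∩p∣≡0 {n} p = trans (cong ∣_∣ (∩-inverseˡ p)) (∣⊥∣≡0 n)

⊤≢∁⁅k⁆ : ∀ {n} (k : Fin n) → ⊤ ≢ ∁ ⁅ k ⁆
⊤≢∁⁅k⁆ k e = x∈p⇒x∉∁p (x∈⁅x⁆ k) (subst (k ∈_) e ∈⊤)

disagree⇒∁ : ∀ {n} (x y : Subset n) → (∀ k → lookup x k ≢ lookup y k) → x ≡ ∁ y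
disagree⇒∁ []          []          _ = refl
disagree⇒∁ (true  ∷ x) (true  ∷ y) h = ⊥-elim (h zero refl)
disagree⇒∁ (false ∷ x) (false ∷ y) h = ⊥-elim (h zero refl)
disagree⇒∁ (true  ∷ x) (false ∷ y) h = cong (true ∷_)  (disagree⇒∁ x y (h ∘ suc))
disagree⇒∁ (false ∷ x) (true  ∷ y) h = cong (false ∷_) (disagree⇒∁ x y (h ∘ suc))

NearlyComplementary : ∀ {n} → Subset n → Subset n → Set
NearlyComplementary x y = MeetOnceCovering x y ⊎ DisjointMissingOne x y ⊎ x ≡ ∁ y

nearlyComplementary-∷ : ∀ {n} a (x y : Subset n) →
                        NearlyComplementary x y → NearlyComplementary (a ∷ x) (not a ∷ y)
nearlyComplementary-∷ true  x y (inj₁ (c , u))            = inj₁ (c , cong (true ∷_) u)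
nearlyComplementary-∷ false x y (inj₁ (c , u))            = inj₁ (c , cong (true ∷_) u)
nearlyComplementary-∷ true  x y (inj₂ (inj₁ (c , k , u))) =
  inj₂ (inj₁ (c , suc k , cong (true ∷_) u))
nearlyComplementary-∷ false x y (inj₂ (inj₁ (c , k , u))) =
  inj₂ (inj₁ (c , suc k , cong (true ∷_) u))
nearlyComplementary-∷ true  x y (inj₂ (inj₂ e))           = inj₂ (inj₂ (cong (true ∷_) e))
nearlyComplementary-∷ false x y (inj₂ (inj₂ e))           = inj₂ (inj₂ (cong (false ∷_) e))

agreeAtMostOnce-∷ : ∀ {n} a b (x y : Subset n) →
                    AgreeAtMostOnce (a ∷ x) (b ∷ y) → AgreeAtMostOnce x y
agreeAtMostOnce-∷ a b x y h i j i≢j = h (suc i) (suc j) (i≢j ∘ suc-injective)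

agreeAtMostOnce⇒nearlyComplementary : ∀ {n} (x y : Subset n) →
                                      AgreeAtMostOnce x y → NearlyComplementary x y
agreeAtMostOnce⇒nearlyComplementary [] [] _ = inj₂ (inj₂ refl)
agreeAtMostOnce⇒nearlyComplementary (true ∷ x) (true ∷ y) h
  with refl ← disagree⇒∁ x y (λ k → h zero (suc k) (λ ()) refl)
  = inj₁ (cong suc (∣∁p∩p∣≡0 y) , cong (true ∷_) (∪-inverseˡ y))
agreeAtMostOnce⇒nearlyComplementary {suc n} (false ∷ x) (false ∷ y) h
  with refl ← disagree⇒∁ x y (λ k → h zero (suc k) (λ ()) refl)
  = inj₂ (inj₁ (∣∁p∩p∣≡0 y , zero ,
      cong (false ∷_) (trans (∪-inverseˡ y) (sym (map-replicate not false n)))))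
agreeAtMostOnce⇒nearlyComplementary (true ∷ x) (false ∷ y) h =
  nearlyComplementary-∷ true x y
    (agreeAtMostOnce⇒nearlyComplementary x y (agreeAtMostOnce-∷ true false x y h))
agreeAtMostOnce⇒nearlyComplementary (false ∷ x) (true ∷ y) h =
  nearlyComplementary-∷ false x y
    (agreeAtMostOnce⇒nearlyComplementary x y (agreeAtMostOnce-∷ false true x y h))

nearlyComplementary-exclusive : ∀ {n} (x y : Subset n) →
  ¬ (MeetOnceCovering x y × DisjointMissingOne x y) ×
  ¬ (MeetOnceCovering x y × x ≡ ∁ y) ×
  ¬ (DisjointMissingOne x y × x ≡ ∁ y)
nearlyComplementary-exclusive x y =
  (λ { ((one , _) , (none , _)) → 1≢0 (trans (sym one) none) }) ,
  (λ { ((one , _) , refl) → 1≢0 (trans (sym one) (∣∁p∩p∣≡0 y)) }) ,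
  (λ { ((_ , k , u) , refl) → ⊤≢∁⁅k⁆ k (trans (sym (∪-inverseˡ y)) u) })
  where
  1≢0 : 1 ≢ 0
  1≢0 ()

lemma4p13 : (n : ℕ) → 2 ≤ n → (B : Family n)
    → ((z : Subset n) → B z ≡ true → evenSize z ≡ true)
    → ((i j : Fin n) → i ≢ j → (z : Subset n) → compress i j B z ≡ B z)
    → ¬ isInitialSegmentEven B
    → (x y : Subset n) → evenSize x ≡ true → B x ≡ false → B y ≡ true → (x ≺ y) ≡ true
    → let P1 = (∣ x ∩ y ∣ ≡ 1) × (x ∪ y ≡ ⊤)
          P2 = (∣ x ∩ y ∣ ≡ 0) × ∃ (λ k → x ∪ y ≡ ∁ ⁅ k ⁆)
          P3 = x ≡ ∁ y
      in (P1 ⊎ P2 ⊎ P3) × ¬ (P1 × P2) × ¬ (P1 × P3) × ¬ (P2 × P3)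
lemma4p13 n _ B even compressed _ x y x-even x∉B y∈B x≺y =
  agreeAtMostOnce⇒nearlyComplementary x y agreeAtMostOnce , nearlyComplementary-exclusive x y
  where
  agreeAtMostOnce : AgreeAtMostOnce x y
  agreeAtMostOnce i j i≢j agree-i agree-j with () ← trans (sym x∉B)
    (Compression.compressed-downClosed B i j i≢j x y agree-i agree-j
       (compressed i j i≢j) (trans x-even (sym (even y y∈B))) y∈B x≺y)
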